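{- For every nonnegative integer $N$, $$p(2N,4,N)-p(2N-1,4,N)=p(N,3)-p(N-1,3)\qquad\text{and}\qquad p(2N-1,4,N)-p(2N-2,4,N)=0.$$
   Context: $p(n,m,N)$ is the number of partitions of $n$ into at most $m$ parts, each at most $N$ (the coefficient of $q^n$ in the Gaussian polynomial $\begin{bmatrix}N+m\\ m\end{bmatrix}_q$), and $p(n,m)$ is the number of partitions of $n$ into at most $m$ parts; both are $0$ for $n<0$, and $p(0,m)=1$. -}

module Defs where

open import Data.Nat using (ℕ; zero; suc; _+_; _∸_; _≤?_)
open import Data.Integer using (ℤ; +_; -[1+_])
open import Relation.Nullary using (yes; no)

sumTo : ℕ → (ℕ → ℕ) → ℕ
sumTo zero    f = f 0
sumTo (suc N) f = sumTo N f + f (suc N)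

-- pN n m N = number of partitions of n into at most m parts, each part ≤ N.
-- Recursion on m by the largest part k (0 ≤ k ≤ N; k = 0 means no parts):
-- a partition of n into ≤ m+1 parts each ≤ N with largest part k is k followed
-- by a partition of n-k into ≤ m parts each ≤ k.
pN : ℕ → ℕ → ℕ → ℕ
pStep : ℕ → ℕ → ℕ → ℕ

pN zero    zero    N = 1
pN (suc n) zero    N = 0
pN n       (suc m) N = sumTo N (pStep n m)

-- pStep n m k = number of partitions of n into ≤ m+1 parts with largest part
-- exactly k (k = 0: the empty partition, only when n = 0)
pStep zero    m zero    = 1
pStep (suc n) m zero    = 0
pStep n       m (suc k) with suc k ≤? n
... | yes _ = pN (n ∸ suc k) m (suc k)
... | no  _ = 0

-- number of partitions of n into at most m parts (parts are ≤ n automatically)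
pℕ : ℕ → ℕ → ℕ
pℕ n m = pN n m n

p₃ : ℤ → ℕ → ℕ → ℤ
p₃ (+ n)    m N = + pN n m N
p₃ -[1+ _ ] m N = + 0

p₂ : ℤ → ℕ → ℤ
p₂ (+ n)    m = + pℕ n m
p₂ -[1+ _ ] m = + 0

-- Write p(n,m) for p₂ and Δₘ(z) = p(z,m) - p(z-1,m).  Splitting off the partitions
-- with exactly m+1 parts gives Δₘ₊₁(z) = Δₘ(z) + Δₘ₊₁(z-m-1), from which Δ₂ is the
-- indicator of the even naturals, Δ₃(2n) = Δ₃(n) + Δ₃(n-1), and hence by telescoping
-- Δ₄(2n) = p(n,3) and Δ₄(2n+1) = p(n-1,3).  On the other side, raising the bound on
-- the parts from K to K+1 adds the partitions with largest part K+1; when n ≤ 2K+2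
-- their remaining parts are automatically ≤ K+1, so there are p(n-K-1,3) of them.
-- Telescoping in K down from K = n gives p(n,4,K) - p(n-1,4,K) = Δ₄(n) - p(n-K-1,3)
-- for n ≤ 2K+2, and the choices n = 2N and n = 2N-1 with K = N give the identities.
module Submission where

open import Defs
open import Data.Nat using (ℕ)
open import Data.Integer using (ℤ; +_; _+_; _-_; _*_)
open import Data.Product using (_×_)
open import Relation.Binary.PropositionalEquality using (_≡_)

open import Data.Nat using (zero; suc; _∸_; _≤?_; s≤s; _≤′_; ≤′-refl; ≤′-step)
  renaming (_+_ to _+ℕ_; _≤_ to _≤ℕ_; _<_ to _<ℕ_)
import Data.Nat.Properties as ℕ
open import Data.Integer using (-[1+_]; _⊖_; _≤_; _<_; +≤+; +<+)
import Data.Integer.Properties as ℤ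
open import Data.Integer.Tactic.RingSolver using (solve-∀)
open import Algebra.Properties.CommutativeSemigroup ℤ.+-commutativeSemigroup
  using (interchange)
open import Data.Product using (_,_)
open import Data.Empty using (⊥-elim)
open import Relation.Nullary using (yes; no)
open import Relation.Binary.PropositionalEquality
  using (refl; sym; trans; cong; cong₂; module ≡-Reasoning)

pStep-≤ : ∀ n m k → suc k ≤ℕ n → pStep n m (suc k) ≡ pN (n ∸ suc k) m (suc k)
pStep-≤ (suc n) m k k<n with suc k ≤? suc n
... | yes _   = refl
... | no  k≮n = ⊥-elim (k≮n k<n)

pStep-> : ∀ n m k → n <ℕ suc k → pStep n m (suc k) ≡ 0
pStep-> zero    m k n<k = refl
pStep-> (suc n) m k n<k with suc k ≤? suc n
... | yes k<n = ⊥-elim (ℕ.<⇒≱ n<k k<n)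
... | no  _   = refl

pN-suc : ∀ n m K → pN n (suc m) K ≡ sumTo K (pStep n m)
pN-suc zero    m K = refl
pN-suc (suc n) m K = refl

pN-bound-suc : ∀ n m K → n ≤ℕ K → pN n m (suc K) ≡ pN n m K
pN-bound-suc zero    zero    K n≤K = refl
pN-bound-suc (suc n) zero    K n≤K = refl
pN-bound-suc n       (suc m) K n≤K = begin
  pN n (suc m) (suc K)                           ≡⟨ pN-suc n m (suc K) ⟩
  sumTo K (pStep n m) +ℕ pStep n m (suc K)       ≡⟨ cong (sumTo K (pStep n m) +ℕ_) (pStep-> n m K (s≤s n≤K)) ⟩
  sumTo K (pStep n m) +ℕ 0                       ≡⟨ ℕ.+-identityʳ _ ⟩
  sumTo K (pStep n m)                            ≡⟨ pN-suc n m K ⟨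
  pN n (suc m) K                                 ∎
  where open ≡-Reasoning

pN-stable : ∀ n m K → n ≤ℕ K → pN n m K ≡ pℕ n m
pN-stable n m K n≤K = go (ℕ.≤⇒≤′ n≤K)
  where
  go : ∀ {K} → n ≤′ K → pN n m K ≡ pℕ n m
  go ≤′-refl          = refl
  go (≤′-step {K} n≤K) = trans (pN-bound-suc n m K (ℕ.≤′⇒≤ n≤K)) (go n≤K)

p₃-stable : ∀ z m K → z ≤ + K → p₃ z m K ≡ p₂ z m
p₃-stable (+ n)    m K (+≤+ n≤K) = cong +_ (pN-stable n m K n≤K)
p₃-stable -[1+ _ ] m K _         = refl

p₂-negative : ∀ z m → z < + 0 → p₂ z m ≡ + 0
p₂-negative -[1+ _ ] m _         = refl
p₂-negative (+ _)    m (+<+ ())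

-- The index + n - + suc k reduces to n ⊖ suc k, which is how these two are applied.
⊖-≤-bound : ∀ n a K → n ≤ℕ a +ℕ K → n ⊖ a ≤ + K
⊖-≤-bound n a K n≤a+K = ℤ.≤-trans (ℤ.⊖-monoˡ-≤ a n≤a+K)
  (ℤ.≤-reflexive (trans (ℤ.≤-⊖ (ℕ.m≤m+n a K)) (cong +_ (ℕ.m+n∸m≡n a K))))

⊖-<-zero : ∀ n a → n <ℕ a → n ⊖ a < + 0
⊖-<-zero n a n<a = ℤ.<-≤-trans (ℤ.⊖-monoˡ-< a n<a) (ℤ.≤-reflexive (ℤ.n⊖n≡0 a))

+pStep≡p₃ : ∀ n m k → + pStep n m (suc k) ≡ p₃ (+ n - + suc k) m (suc k)
+pStep≡p₃ n m k with suc k ≤? n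
... | yes k<n rewrite ℤ.⊖-≥ k<n = cong +_ (pStep-≤ n m k k<n)
... | no  k≮n rewrite ℤ.⊖-≰ k≮n | ℕ.+-∸-assoc 1 (ℕ.≮⇒≥ k≮n) = cong +_ (pStep-> n m k (ℕ.≰⇒> k≮n))

p₃-by-largest-part : ∀ z m K → p₃ z (suc m) (suc K) ≡ p₃ z (suc m) K + p₃ (z - + suc K) m (suc K)
p₃-by-largest-part -[1+ _ ] m K = refl
p₃-by-largest-part (+ n)    m K = begin
  + pN n (suc m) (suc K)                                 ≡⟨ cong +_ (pN-suc n m (suc K)) ⟩
  + sumTo K (pStep n m) + + pStep n m (suc K)            ≡⟨ cong₂ _+_ (cong +_ (sym (pN-suc n m K))) (+pStep≡p₃ n m K) ⟩
  + pN n (suc m) K + p₃ (+ n - + suc K) m (suc K)        ∎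
  where open ≡-Reasoning

p₃-no-parts : ∀ z K K′ → p₃ z 0 K ≡ p₃ z 0 K′
p₃-no-parts (+ zero)  K K′ = refl
p₃-no-parts (+ suc _) K K′ = refl
p₃-no-parts -[1+ _ ]  K K′ = refl

p₃-zero-bound : ∀ z m m′ → p₃ z m 0 ≡ p₃ z m′ 0
p₃-zero-bound z m m′ = trans (to-no-parts z m) (sym (to-no-parts z m′))
  where
  to-no-parts : ∀ z m → p₃ z m 0 ≡ p₃ z 0 0
  to-no-parts z         zero    = refl
  to-no-parts (+ zero)  (suc m) = refl
  to-no-parts (+ suc _) (suc m) = refl
  to-no-parts -[1+ _ ]  (suc m) = refl

p₃-zero-bound≡no-parts : ∀ z m K → p₃ z m 0 ≡ p₃ z 0 K
p₃-zero-bound≡no-parts z m K = trans (p₃-zero-bound z m 0) (p₃-no-parts z 0 K)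

sub-suc : ∀ z k → z - (+ 1 + k) ≡ (z - + 1) - k
sub-suc = solve-∀

plus-minus : ∀ a b → (a + b) - b ≡ a
plus-minus = solve-∀

sub-swap : ∀ z a b → (z - (+ 2 + a)) - (+ 1 + b) ≡ (z - (+ 2 + b)) - (+ 1 + a)
sub-swap = solve-∀

-- Split off the partitions with exactly m+1 parts and subtract 1 from each of
-- their parts.
p₃-by-length : ∀ m K z → p₃ z (suc m) (suc K) ≡ p₃ z m (suc K) + p₃ (z - + suc m) (suc m) K
p₃-by-length zero zero z =
  trans (p₃-by-largest-part z 0 0)
        (cong₂ _+_ (p₃-zero-bound≡no-parts z 1 1) (sym (p₃-zero-bound≡no-parts (z - + 1) 1 1)))
p₃-by-length zero (suc K) z = begin
  p₃ z 1 (suc (suc K))                                          ≡⟨ p₃-by-largest-part z 0 (suc K) ⟩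
  p₃ z 1 (suc K) + p₃ (z - + suc (suc K)) 0 (suc (suc K))       ≡⟨ cong (_+ p₃ (z - + suc (suc K)) 0 (suc (suc K))) (p₃-by-length zero K z) ⟩
  (p₃ z 0 (suc K) + p₃ (z - + 1) 1 K) + p₃ (z - + suc (suc K)) 0 (suc (suc K))
    ≡⟨ cong₂ (λ a b → (a + p₃ (z - + 1) 1 K) + b) (p₃-no-parts z _ _)
             (trans (p₃-no-parts _ _ _) (cong (λ w → p₃ w 0 (suc K)) (sub-suc z (+ suc K)))) ⟩
  (p₃ z 0 (suc (suc K)) + p₃ (z - + 1) 1 K) + p₃ ((z - + 1) - + suc K) 0 (suc K)
    ≡⟨ ℤ.+-assoc (p₃ z 0 (suc (suc K))) _ _ ⟩
  p₃ z 0 (suc (suc K)) + (p₃ (z - + 1) 1 K + p₃ ((z - + 1) - + suc K) 0 (suc K))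
    ≡⟨ cong (_+_ (p₃ z 0 (suc (suc K)))) (p₃-by-largest-part (z - + 1) 0 K) ⟨
  p₃ z 0 (suc (suc K)) + p₃ (z - + 1) 1 (suc K)                 ∎
  where open ≡-Reasoning
p₃-by-length (suc m) zero z = begin
  p₃ z (suc (suc m)) 1                                          ≡⟨ p₃-by-largest-part z (suc m) 0 ⟩
  p₃ z (suc (suc m)) 0 + p₃ (z - + 1) (suc m) 1                 ≡⟨ cong (_+_ (p₃ z (suc (suc m)) 0)) (p₃-by-length m zero (z - + 1)) ⟩
  p₃ z (suc (suc m)) 0 + (p₃ (z - + 1) m 1 + p₃ ((z - + 1) - + suc m) (suc m) 0)
    ≡⟨ ℤ.+-assoc (p₃ z (suc (suc m)) 0) _ _ ⟨
  (p₃ z (suc (suc m)) 0 + p₃ (z - + 1) m 1) + p₃ ((z - + 1) - + suc m) (suc m) 0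
    ≡⟨ cong₂ (λ a b → (a + p₃ (z - + 1) m 1) + b) (p₃-zero-bound z _ _)
             (trans (cong (λ w → p₃ w (suc m) 0) (sym (sub-suc z (+ suc m)))) (p₃-zero-bound _ _ _)) ⟩
  (p₃ z (suc m) 0 + p₃ (z - + 1) m 1) + p₃ (z - + suc (suc m)) (suc (suc m)) 0
    ≡⟨ cong (_+ p₃ (z - + suc (suc m)) (suc (suc m)) 0) (p₃-by-largest-part z m 0) ⟨
  p₃ z (suc m) 1 + p₃ (z - + suc (suc m)) (suc (suc m)) 0       ∎
  where open ≡-Reasoning
p₃-by-length (suc m) (suc K) z = begin
  p₃ z (suc (suc m)) (suc (suc K))                              ≡⟨ p₃-by-largest-part z (suc m) (suc K) ⟩
  p₃ z (suc (suc m)) (suc K) + p₃ (z - + suc (suc K)) (suc m) (suc (suc K))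
    ≡⟨ cong₂ _+_ (p₃-by-length (suc m) K z) (p₃-by-length m (suc K) (z - + suc (suc K))) ⟩
  (a + c) + (b + d)                                             ≡⟨ interchange a c b d ⟩
  (a + b) + (c + d)                                             ≡⟨ cong (λ w → (a + b) + (c + p₃ w (suc m) (suc K))) (sub-swap z (+ K) (+ m)) ⟩
  (a + b) + (c + p₃ ((z - + suc (suc m)) - + suc K) (suc m) (suc K))
    ≡⟨ cong₂ _+_ (p₃-by-largest-part z m (suc K)) (p₃-by-largest-part (z - + suc (suc m)) (suc m) K) ⟨
  p₃ z (suc m) (suc (suc K)) + p₃ (z - + suc (suc m)) (suc (suc m)) (suc K) ∎
  where
  open ≡-Reasoning
  a = p₃ z (suc m) (suc K)
  b = p₃ (z - + suc (suc K)) m (suc (suc K))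
  c = p₃ (z - + suc (suc m)) (suc (suc m)) K
  d = p₃ ((z - + suc (suc K)) - + suc m) (suc m) (suc K)

p₂-by-length : ∀ z m → p₂ z (suc m) ≡ p₂ z m + p₂ (z - + suc m) (suc m)
p₂-by-length -[1+ _ ] m = refl
p₂-by-length (+ n)    m = begin
  p₂ (+ n) (suc m)                                     ≡⟨ p₃-stable (+ n) (suc m) (suc n) n≤1+n ⟨
  p₃ (+ n) (suc m) (suc n)                             ≡⟨ p₃-by-length m n (+ n) ⟩
  p₃ (+ n) m (suc n) + p₃ (+ n - + suc m) (suc m) n
    ≡⟨ cong₂ _+_ (p₃-stable (+ n) m (suc n) n≤1+n)
                 (p₃-stable (n ⊖ suc m) (suc m) n (⊖-≤-bound n (suc m) n (ℕ.m≤n+m n (suc m)))) ⟩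
  p₂ (+ n) m + p₂ (+ n - + suc m) (suc m)              ∎
  where
  open ≡-Reasoning
  n≤1+n : + n ≤ + suc n
  n≤1+n = +≤+ (ℕ.n≤1+n n)

Δp₂ : ℕ → ℤ → ℤ
Δp₂ m z = p₂ z m - p₂ (z - + 1) m

Δp₂-by-length : ∀ m z → Δp₂ (suc m) z ≡ Δp₂ m z + Δp₂ (suc m) (z - + suc m)
Δp₂-by-length m z = begin
  p₂ z (suc m) - p₂ (z - + 1) (suc m)
    ≡⟨ cong₂ _-_ (p₂-by-length z m) (p₂-by-length (z - + 1) m) ⟩
  (p₂ z m + p₂ (z - + suc m) (suc m)) - (p₂ (z - + 1) m + p₂ ((z - + 1) - + suc m) (suc m))
    ≡⟨ cong (λ w → (p₂ z m + p₂ (z - + suc m) (suc m)) - (p₂ (z - + 1) m + p₂ w (suc m))) (sub-comm z (+ 1) (+ suc m)) ⟩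
  (p₂ z m + p₂ (z - + suc m) (suc m)) - (p₂ (z - + 1) m + p₂ ((z - + suc m) - + 1) (suc m))
    ≡⟨ +-minus-+ (p₂ z m) _ _ _ ⟩
  Δp₂ m z + Δp₂ (suc m) (z - + suc m)                    ∎
  where
  open ≡-Reasoning
  sub-comm : ∀ z a b → (z - a) - b ≡ (z - b) - a
  sub-comm = solve-∀
  +-minus-+ : ∀ a b c d → (a + b) - (c + d) ≡ (a - c) + (b - d)
  +-minus-+ = solve-∀

Δp₂-one : ∀ z → Δp₂ 1 z ≡ p₂ z 0
Δp₂-one z = trans (cong (_- p₂ (z - + 1) 1) (p₂-by-length z 0)) (plus-minus (p₂ z 0) (p₂ (z - + 1) 1))

Δp₂-two-period : ∀ k → Δp₂ 2 (+ suc (suc k)) ≡ Δp₂ 2 (+ k)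
Δp₂-two-period k = trans (Δp₂-by-length 1 (+ suc (suc k)))
                         (trans (cong (_+ Δp₂ 2 (+ k)) (Δp₂-one (+ suc (suc k)))) (ℤ.+-identityˡ _))

double : ℕ → ℕ
double zero    = zero
double (suc n) = suc (suc (double n))

double≡+ : ∀ n → double n ≡ n +ℕ n
double≡+ zero    = refl
double≡+ (suc n) = cong suc (trans (cong suc (double≡+ n)) (sym (ℕ.+-suc n n)))

Δp₂-two-even : ∀ k → Δp₂ 2 (+ double k) ≡ + 1
Δp₂-two-even zero    = refl
Δp₂-two-even (suc k) = trans (Δp₂-two-period (double k)) (Δp₂-two-even k)

Δp₂-two-odd : ∀ k → Δp₂ 2 (+ suc (double k)) ≡ + 0
Δp₂-two-odd zero    = refl
Δp₂-two-odd (suc k) = trans (Δp₂-two-period (suc (double k))) (Δp₂-two-odd k)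

Δp₂-two-adjacent : ∀ k → Δp₂ 2 (+ suc k) + Δp₂ 2 (+ k) ≡ + 1
Δp₂-two-adjacent zero          = refl
Δp₂-two-adjacent (suc zero)    = refl
Δp₂-two-adjacent (suc (suc k)) =
  trans (cong₂ _+_ (Δp₂-two-period (suc k)) (Δp₂-two-period k)) (Δp₂-two-adjacent k)

Δp₂-three-double : ∀ n → Δp₂ 3 (+ double n) ≡ Δp₂ 3 (+ n) + Δp₂ 3 (+ n - + 1)
Δp₂-three-double zero                = refl
Δp₂-three-double (suc zero)          = refl
Δp₂-three-double (suc (suc zero))    = refl
Δp₂-three-double (suc (suc (suc k))) = begin
  Δp₂ 3 (+ double (suc (suc (suc k))))
    ≡⟨ Δp₂-by-length 2 (+ double (suc (suc (suc k)))) ⟩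
  Δp₂ 2 (+ double (suc (suc (suc k)))) + Δp₂ 3 (+ suc (double (suc k)))
    ≡⟨ cong (_+_ (Δp₂ 2 (+ double (suc (suc (suc k)))))) (Δp₂-by-length 2 (+ suc (double (suc k)))) ⟩
  Δp₂ 2 (+ double (suc (suc (suc k)))) + (Δp₂ 2 (+ suc (double (suc k))) + Δp₂ 3 (+ double k))
    ≡⟨ cong₂ (λ a b → a + (b + Δp₂ 3 (+ double k))) (Δp₂-two-even (suc (suc (suc k)))) (Δp₂-two-odd (suc k)) ⟩
  + 1 + (+ 0 + Δp₂ 3 (+ double k))
    ≡⟨ cong (λ w → + 1 + w) (trans (ℤ.+-identityˡ _) (Δp₂-three-double k)) ⟩
  + 1 + (Δp₂ 3 (+ k) + Δp₂ 3 (+ k - + 1))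
    ≡⟨ cong (_+ (Δp₂ 3 (+ k) + Δp₂ 3 (+ k - + 1))) (Δp₂-two-adjacent (suc (suc k))) ⟨
  (Δp₂ 2 (+ suc (suc (suc k))) + Δp₂ 2 (+ suc (suc k))) + (Δp₂ 3 (+ k) + Δp₂ 3 (+ k - + 1))
    ≡⟨ interchange (Δp₂ 2 (+ suc (suc (suc k)))) (Δp₂ 2 (+ suc (suc k))) (Δp₂ 3 (+ k)) (Δp₂ 3 (+ k - + 1)) ⟩
  (Δp₂ 2 (+ suc (suc (suc k))) + Δp₂ 3 (+ k)) + (Δp₂ 2 (+ suc (suc k)) + Δp₂ 3 (+ k - + 1))
    ≡⟨ cong₂ _+_ (Δp₂-by-length 2 (+ suc (suc (suc k)))) three-back ⟨
  Δp₂ 3 (+ suc (suc (suc k))) + Δp₂ 3 (+ suc (suc k))        ∎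
  where
  open ≡-Reasoning
  two-minus-three : ∀ x → (+ 2 + x) - + 3 ≡ x - + 1
  two-minus-three = solve-∀
  three-back : Δp₂ 3 (+ suc (suc k)) ≡ Δp₂ 2 (+ suc (suc k)) + Δp₂ 3 (+ k - + 1)
  three-back = trans (Δp₂-by-length 2 (+ suc (suc k))) (cong (λ w → Δp₂ 2 (+ suc (suc k)) + Δp₂ 3 w) (two-minus-three (+ k)))

telescope : ∀ a b c → ((a - b) + (b - c)) + c ≡ a
telescope = solve-∀

Δp₂-four-double : ∀ n → Δp₂ 4 (+ double n) ≡ p₂ (+ n) 3
Δp₂-four-double zero          = refl
Δp₂-four-double (suc zero)    = refl
Δp₂-four-double (suc (suc k)) = begin
  Δp₂ 4 (+ double (suc (suc k)))                             ≡⟨ Δp₂-by-length 3 (+ double (suc (suc k))) ⟩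
  Δp₂ 3 (+ double (suc (suc k))) + Δp₂ 4 (+ double k)        ≡⟨ cong₂ _+_ (Δp₂-three-double (suc (suc k))) (Δp₂-four-double k) ⟩
  (Δp₂ 3 (+ suc (suc k)) + Δp₂ 3 (+ suc k)) + p₂ (+ k) 3     ≡⟨ telescope (p₂ (+ suc (suc k)) 3) (p₂ (+ suc k) 3) (p₂ (+ k) 3) ⟩
  p₂ (+ suc (suc k)) 3                                       ∎
  where open ≡-Reasoning

Δp₂-four-double-suc : ∀ n → Δp₂ 4 (+ suc (double n)) ≡ p₂ (+ n - + 1) 3
Δp₂-four-double-suc zero          = refl
Δp₂-four-double-suc (suc zero)    = refl
Δp₂-four-double-suc (suc (suc k)) = begin
  Δp₂ 4 (+ suc (double (suc (suc k))))                       ≡⟨ Δp₂-by-length 3 (+ suc (double (suc (suc k)))) ⟩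
  Δp₂ 3 (+ suc (double (suc (suc k)))) + Δp₂ 4 (+ suc (double k))
    ≡⟨ cong₂ _+_ three-odd (Δp₂-four-double-suc k) ⟩
  (Δp₂ 3 (+ suc k) + Δp₂ 3 (+ k)) + p₂ (+ k - + 1) 3         ≡⟨ telescope (p₂ (+ suc k) 3) (p₂ (+ k) 3) (p₂ (+ k - + 1) 3) ⟩
  p₂ (+ suc k) 3                                             ∎
  where
  open ≡-Reasoning
  three-odd : Δp₂ 3 (+ suc (double (suc (suc k)))) ≡ Δp₂ 3 (+ suc k) + Δp₂ 3 (+ k)
  three-odd = begin
    Δp₂ 3 (+ suc (double (suc (suc k))))                       ≡⟨ Δp₂-by-length 2 (+ suc (double (suc (suc k)))) ⟩
    Δp₂ 2 (+ suc (double (suc (suc k)))) + Δp₂ 3 (+ double (suc k))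
      ≡⟨ cong₂ _+_ (Δp₂-two-odd (suc (suc k))) (Δp₂-three-double (suc k)) ⟩
    + 0 + (Δp₂ 3 (+ suc k) + Δp₂ 3 (+ k))                      ≡⟨ ℤ.+-identityˡ _ ⟩
    Δp₂ 3 (+ suc k) + Δp₂ 3 (+ k)                              ∎

Δp₃-corrected : ℕ → ℕ → ℕ → ℤ
Δp₃-corrected m K n = p₃ (+ n) (suc m) K - p₃ (+ n - + 1) (suc m) K + p₂ (+ n - + suc K) m

Δp₃-corrected-suc : ∀ m K n → n ≤ℕ suc K +ℕ suc K → Δp₃-corrected m (suc K) n ≡ Δp₃-corrected m K n
Δp₃-corrected-suc m K n n≤2K+2 = begin
  p₃ (+ n) (suc m) (suc K) - p₃ (+ n - + 1) (suc m) (suc K) + c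
    ≡⟨ cong₂ (λ u v → u - v + c) (p₃-by-largest-part (+ n) m K) (p₃-by-largest-part (+ n - + 1) m K) ⟩
  (A + p₃ (+ n - + suc K) m (suc K)) - (B + p₃ ((+ n - + 1) - + suc K) m (suc K)) + c
    ≡⟨ cong₂ (λ u v → (A + u) - (B + v) + c)
             (p₃-stable (n ⊖ suc K) m (suc K) (⊖-≤-bound n (suc K) (suc K) n≤2K+2))
             (trans (cong (λ w → p₃ w m (suc K)) (sym (sub-suc (+ n) (+ suc K))))
                    (p₃-stable (n ⊖ suc (suc K)) m (suc K) (⊖-≤-bound n (suc (suc K)) (suc K) (ℕ.m≤n⇒m≤1+n n≤2K+2)))) ⟩
  (A + a) - (B + c) + c                                           ≡⟨ cancel A B a c ⟩
  A - B + a                                                       ∎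
  where
  open ≡-Reasoning
  A = p₃ (+ n) (suc m) K
  B = p₃ (+ n - + 1) (suc m) K
  a = p₂ (+ n - + suc K) m
  c = p₂ (+ n - + suc (suc K)) m
  cancel : ∀ A B a c → (A + a) - (B + c) + c ≡ A - B + a
  cancel = solve-∀

Δp₃-corrected-large : ∀ m K n → n ≤ℕ K → Δp₃-corrected m K n ≡ Δp₂ (suc m) (+ n)
Δp₃-corrected-large m K n n≤K = begin
  p₃ (+ n) (suc m) K - p₃ (+ n - + 1) (suc m) K + p₂ (+ n - + suc K) m
    ≡⟨ cong₂ (λ u v → u - v + p₂ (+ n - + suc K) m)
             (p₃-stable (+ n) (suc m) K (+≤+ n≤K))
             (p₃-stable (n ⊖ 1) (suc m) K (⊖-≤-bound n 1 K (ℕ.m≤n⇒m≤1+n n≤K))) ⟩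
  Δp₂ (suc m) (+ n) + p₂ (+ n - + suc K) m
    ≡⟨ cong (_+_ (Δp₂ (suc m) (+ n))) (p₂-negative (n ⊖ suc K) m (⊖-<-zero n (suc K) (s≤s n≤K))) ⟩
  Δp₂ (suc m) (+ n) + + 0                                         ≡⟨ ℤ.+-identityʳ _ ⟩
  Δp₂ (suc m) (+ n)                                               ∎
  where open ≡-Reasoning

Δp₃-corrected≡Δp₂ : ∀ m K n → n ≤ℕ suc K +ℕ suc K → Δp₃-corrected m K n ≡ Δp₂ (suc m) (+ n)
Δp₃-corrected≡Δp₂ m K n n≤2K+2 =
  trans (sym (raise n)) (Δp₃-corrected-large m (n +ℕ K) n (ℕ.m≤m+n n K))
  where
  raise : ∀ d → Δp₃-corrected m (d +ℕ K) n ≡ Δp₃-corrected m K n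
  raise zero    = refl
  raise (suc d) = trans (Δp₃-corrected-suc m (d +ℕ K) n (ℕ.≤-trans n≤2K+2 (ℕ.+-mono-≤ K≤ K≤))) (raise d)
    where
    K≤ : suc K ≤ℕ suc (d +ℕ K)
    K≤ = s≤s (ℕ.m≤n+m K d)

Δp₃-difference : ∀ m K n → n ≤ℕ suc K +ℕ suc K →
  p₃ (+ n) (suc m) K - p₃ (+ n - + 1) (suc m) K ≡ Δp₂ (suc m) (+ n) - p₂ (+ n - + suc K) m
Δp₃-difference m K n n≤2K+2 =
  trans (sym (plus-minus _ (p₂ (+ n - + suc K) m))) (cong (_- p₂ (+ n - + suc K) m) (Δp₃-corrected≡Δp₂ m K n n≤2K+2))

double<2+2n : ∀ n → double n <ℕ suc n +ℕ suc n
double<2+2n n = s≤s (ℕ.≤-trans (ℕ.≤-reflexive (double≡+ n)) (ℕ.+-monoʳ-≤ n (ℕ.n≤1+n n)))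

Δp₃-four-double : ∀ N → p₃ (+ double N) 4 N - p₃ (+ double N - + 1) 4 N ≡ p₂ (+ N) 3 - p₂ (+ N - + 1) 3
Δp₃-four-double N = begin
  p₃ (+ double N) 4 N - p₃ (+ double N - + 1) 4 N   ≡⟨ Δp₃-difference 3 N (double N) (ℕ.<⇒≤ (double<2+2n N)) ⟩
  Δp₂ 4 (+ double N) - p₂ (+ double N - + suc N) 3
    ≡⟨ cong₂ (λ u w → u - p₂ w 3) (Δp₂-four-double N) (trans (cong (λ k → + k - + suc N) (double≡+ N)) (index (+ N))) ⟩
  p₂ (+ N) 3 - p₂ (+ N - + 1) 3                     ∎
  where
  open ≡-Reasoning
  index : ∀ x → (x + x) - (+ 1 + x) ≡ x - + 1
  index = solve-∀

Δp₃-four-double-suc : ∀ M → p₃ (+ suc (double M)) 4 (suc M) - p₃ (+ double M) 4 (suc M) ≡ + 0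
Δp₃-four-double-suc M = begin
  p₃ (+ suc (double M)) 4 (suc M) - p₃ (+ double M) 4 (suc M)
    ≡⟨ Δp₃-difference 3 (suc M) (suc (double M)) 2M+1≤2M+4 ⟩
  Δp₂ 4 (+ suc (double M)) - p₂ (+ suc (double M) - + suc (suc M)) 3
    ≡⟨ cong₂ (λ u w → u - p₂ w 3) (Δp₂-four-double-suc M) (trans (cong (λ k → + suc k - + suc (suc M)) (double≡+ M)) (index (+ M))) ⟩
  p₂ (+ M - + 1) 3 - p₂ (+ M - + 1) 3               ≡⟨ ℤ.+-inverseʳ (p₂ (+ M - + 1) 3) ⟩
  + 0                                               ∎
  where
  open ≡-Reasoning
  index : ∀ x → (+ 1 + (x + x)) - (+ 2 + x) ≡ x - + 1
  index = solve-∀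
  2M+1≤2M+4 : suc (double M) ≤ℕ suc (suc M) +ℕ suc (suc M)
  2M+1≤2M+4 = ℕ.≤-trans (double<2+2n M) (ℕ.+-mono-≤ (ℕ.n≤1+n (suc M)) (ℕ.n≤1+n (suc M)))

+2*≡double : ∀ N → + 2 * + N ≡ + double N
+2*≡double N = trans (two-times (+ N)) (cong +_ (sym (double≡+ N)))
  where
  two-times : ∀ x → + 2 * x ≡ x + x
  two-times = solve-∀

proposition1p14 : (N : ℕ) →
    ((p₃ (+ 2 * + N) 4 N - p₃ (+ 2 * + N - + 1) 4 N) ≡ (p₂ (+ N) 3 - p₂ (+ N - + 1) 3))
    × ((p₃ (+ 2 * + N - + 1) 4 N - p₃ (+ 2 * + N - + 2) 4 N) ≡ + 0)
proposition1p14 N rewrite +2*≡double N = Δp₃-four-double N , odd-part N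
  where
  odd-part : ∀ N → p₃ (+ double N - + 1) 4 N - p₃ (+ double N - + 2) 4 N ≡ + 0
  odd-part zero    = refl
  odd-part (suc M) = Δp₃-four-double-suc M
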